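{- For all $n \ge 1$, $A_n \cap D_n = \emptyset$, and every vertex of $D_n$ has degree exactly $1$ in the subgraph of $H(n,3)$ induced by $D_n$.
   Context: $H(n,3)$ is the Hamming graph on $\mathbb{Z}_3^n$ (vertices adjacent iff they differ in exactly one coordinate). $A_n = \{x \in \mathbb{Z}_3^n : \sum_i x_i \equiv 0 \pmod 3\}$. For $S \subseteq \mathbb{Z}_3^{n}$ and $c \in \mathbb{Z}_3$, write $(S,c) = \{(x_1,\dots,x_{n},c) : (x_1,\dots,x_n) \in S\} \subseteq \mathbb{Z}_3^{n+1}$. The sets $D_n \subseteq \mathbb{Z}_3^n$ are defined recursively by $D_1 = \{1,2\}$ and $D_{n+1} = (D_n,0) \cup (A_n,1) \cup (A_n,2)$. -}

module Defs where

open import Data.Nat using (ℕ; zero; suc; _%_; _+_)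
open import Data.Fin using (Fin; toℕ; zero; suc)
open import Data.Vec using (Vec; init; last; foldr; map; lookup)
open import Data.Product using (Σ; _×_; ∃; ∃-syntax)
open import Relation.Binary.PropositionalEquality using (_≡_; _≢_)
open import Relation.Nullary using (¬_)

ℤ₃ : Set
ℤ₃ = Fin 3

Vertex : ℕ → Set
Vertex n = Vec ℤ₃ n

coordSum : ∀ {n} → Vertex n → ℕ
coordSum x = foldr _ _+_ 0 (map toℕ x)

A : (n : ℕ) → Vertex n → Set
A n x = coordSum x % 3 ≡ 0

-- D_1 = {1,2};  D_{n+1} = (D_n,0) ∪ (A_n,1) ∪ (A_n,2)
-- where (S,c) consists of vectors whose first n coordinates lie in S and
-- whose last coordinate is c.  D_0 is never used (n ≥ 1); we set it empty.
data D : (n : ℕ) → Vertex n → Set where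
  D-one   : ∀ {x} → ¬ (lookup x zero ≡ zero) → D 1 x
  D-zero  : ∀ {n} {x : Vertex (suc (suc n))} →
            D (suc n) (init x) → last x ≡ zero → D (suc (suc n)) x
  D-one'  : ∀ {n} {x : Vertex (suc (suc n))} →
            A (suc n) (init x) → last x ≡ suc zero → D (suc (suc n)) x
  D-two   : ∀ {n} {x : Vertex (suc (suc n))} →
            A (suc n) (init x) → last x ≡ suc (suc zero) → D (suc (suc n)) x

Adjacent : ∀ {n} → Vertex n → Vertex n → Set
Adjacent {n} x y =
  ∃[ i ] (lookup x i ≢ lookup y i × (∀ j → j ≢ i → lookup x j ≡ lookup y j))

DegreeOneIn : ∀ {n} → (Vertex n → Set) → Vertex n → Set
DegreeOneIn {n} S x =
  ∃[ y ] ((S y × Adjacent x y) × (∀ z → S z → Adjacent x z → z ≡ y))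

{-# OPTIONS --safe #-}

-- Adjacent vertices of H(n,3) differ in exactly one coordinate, so their
-- coordinate sums differ mod 3: A_n is an independent set.  By induction every
-- vertex of D_n has nonzero sum mod 3, i.e. D_n ∩ A_n = ∅.  For the degree,
-- write x = (u,a).  If a = 0 then u ∈ D_n, and a neighbour (u,c) with c ≠ 0
-- would put u in A_n ∩ D_n, so the only neighbour of x in D_{n+1} is (v,0) for
-- the unique neighbour v of u in D_n.  If a ≠ 0 then u ∈ A_n; the neighbour
-- (u,0) would put u in D_n ∩ A_n and a neighbour (v,a) would give two adjacent
-- vertices of A_n, so the only neighbour is (u,b) for the other nonzero b.
module Submission where

open import Defs
open import Data.Nat using (ℕ; zero; suc; _+_; _%_; NonZero)
open import Data.Nat.Properties using (+-suc; +-assoc; +-comm; +-identityʳ)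
open import Data.Nat.DivMod using ([m+n]%n≡m%n; %-distribˡ-+; %-remove-+ˡ; m<n⇒m%n≡m)
open import Data.Nat.Divisibility using (m%n≡0⇒n∣m)
open import Data.Fin using (zero; suc; toℕ)
open import Data.Fin.Properties using (suc-injective; toℕ-injective; toℕ<n)
open import Data.Vec using ([]; _∷_; _∷ʳ_; initLast)
open import Data.Vec.Properties using (∷ʳ-injective; init-∷ʳ; last-∷ʳ)
open import Data.Vec.Relation.Binary.Pointwise.Extensional using (ext; Pointwise-≡⇒≡)
open import Data.Product using (_×_; _,_; ∃-syntax)
open import Data.Sum using (_⊎_; inj₁; inj₂)
open import Data.Empty using (⊥-elim)
open import Function using (_∘_)
open import Relation.Nullary using (¬_)
open import Relation.Binary.PropositionalEquality
  using (_≡_; _≢_; refl; sym; trans; cong; subst; module ≡-Reasoning)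

private
  variable
    m : ℕ
    a b : ℤ₃
    u v : Vertex m

-- i + n = suc i + (n ∸ 1), so the residue of i is determined by that of suc i.
%-suc-injective : ∀ i j n .{{_ : NonZero n}} → suc i % n ≡ suc j % n → i % n ≡ j % n
%-suc-injective i j n@(suc p) eq = begin
  i % n                      ≡⟨ %-via-suc i ⟩
  (suc i % n + p % n) % n    ≡⟨ cong (λ r → (r + p % n) % n) eq ⟩
  (suc j % n + p % n) % n    ≡⟨ %-via-suc j ⟨
  j % n                      ∎
  where
  open ≡-Reasoning
  %-via-suc : ∀ k → k % n ≡ (suc k % n + p % n) % n
  %-via-suc k = begin
    k % n                    ≡⟨ [m+n]%n≡m%n k n ⟨
    (k + n) % n              ≡⟨ cong (_% n) (+-suc k p) ⟩
    (suc k + p) % n          ≡⟨ %-distribˡ-+ (suc k) p n ⟩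
    (suc k % n + p % n) % n  ∎

%-cancelˡ-+ : ∀ k i j n .{{_ : NonZero n}} → (k + i) % n ≡ (k + j) % n → i % n ≡ j % n
%-cancelˡ-+ zero    i j n eq = eq
%-cancelˡ-+ (suc k) i j n eq = %-cancelˡ-+ k i j n (%-suc-injective (k + i) (k + j) n eq)

%-cancelʳ-+ : ∀ k i j n .{{_ : NonZero n}} → (i + k) % n ≡ (j + k) % n → i % n ≡ j % n
%-cancelʳ-+ k i j n eq =
  %-cancelˡ-+ k i j n (trans (cong (_% n) (+-comm k i)) (trans eq (cong (_% n) (+-comm j k))))

Adjacent-here : a ≢ b → Adjacent (a ∷ u) (b ∷ u)
Adjacent-here a≢b = zero , a≢b , λ where
  zero    0≢0 → ⊥-elim (0≢0 refl)
  (suc j) _   → refl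

Adjacent-there : Adjacent u v → Adjacent (a ∷ u) (a ∷ v)
Adjacent-there (i , differ , agree) = suc i , differ , λ where
  zero    _   → refl
  (suc j) j≢i → agree j (j≢i ∘ cong suc)

Adjacent-∷⁻ : Adjacent (a ∷ u) (b ∷ v) → (a ≢ b × u ≡ v) ⊎ (a ≡ b × Adjacent u v)
Adjacent-∷⁻ (zero , differ , agree) =
  inj₁ (differ , Pointwise-≡⇒≡ (ext λ j → agree (suc j) λ ()))
Adjacent-∷⁻ (suc i , differ , agree) =
  inj₂ (agree zero (λ ()) , i , differ , λ j j≢i → agree (suc j) (j≢i ∘ suc-injective))

Adjacent-∷ʳ-init : ∀ (u v : Vertex m) → Adjacent u v → Adjacent (u ∷ʳ a) (v ∷ʳ a)
Adjacent-∷ʳ-init {a = a} (_ ∷ u) (_ ∷ v) adj with Adjacent-∷⁻ adj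
... | inj₁ (differ , refl) = Adjacent-here differ
... | inj₂ (refl , adj′)   = Adjacent-there (Adjacent-∷ʳ-init {a = a} u v adj′)

Adjacent-∷ʳ-last : ∀ (u : Vertex m) → a ≢ b → Adjacent (u ∷ʳ a) (u ∷ʳ b)
Adjacent-∷ʳ-last []      a≢b = Adjacent-here a≢b
Adjacent-∷ʳ-last (_ ∷ u) a≢b = Adjacent-there (Adjacent-∷ʳ-last u a≢b)

Adjacent-∷ʳ⁻ : ∀ (u v : Vertex m) → Adjacent (u ∷ʳ a) (v ∷ʳ b) →
               (a ≡ b × Adjacent u v) ⊎ (a ≢ b × u ≡ v)
Adjacent-∷ʳ⁻ [] [] adj with Adjacent-∷⁻ adj
... | inj₁ (a≢b , _)     = inj₂ (a≢b , refl)
... | inj₂ (_ , () , _)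
Adjacent-∷ʳ⁻ (_ ∷ u) (_ ∷ v) adj with Adjacent-∷⁻ adj
... | inj₁ (differ , eq) with ∷ʳ-injective u v eq
...   | refl , refl = inj₁ (refl , Adjacent-here differ)
Adjacent-∷ʳ⁻ (_ ∷ u) (_ ∷ v) adj | inj₂ (refl , adj′) with Adjacent-∷ʳ⁻ u v adj′
...   | inj₁ (a≡b , adj″) = inj₁ (a≡b , Adjacent-there adj″)
...   | inj₂ (a≢b , refl) = inj₂ (a≢b , refl)

coordSum-∷ʳ : (u : Vertex m) (a : ℤ₃) → coordSum (u ∷ʳ a) ≡ coordSum u + toℕ a
coordSum-∷ʳ []      a = +-identityʳ (toℕ a)
coordSum-∷ʳ (b ∷ u) a = trans (cong (toℕ b +_) (coordSum-∷ʳ u a)) (sym (+-assoc (toℕ b) _ _))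

Adjacent⇒coordSum%3≢ : ∀ (u v : Vertex m) → Adjacent u v → coordSum u % 3 ≢ coordSum v % 3
Adjacent⇒coordSum%3≢ (a ∷ u) (b ∷ v) adj eq with Adjacent-∷⁻ adj
... | inj₁ (a≢b , refl) = a≢b (toℕ-injective (begin
  toℕ a      ≡⟨ m<n⇒m%n≡m (toℕ<n a) ⟨
  toℕ a % 3  ≡⟨ %-cancelʳ-+ (coordSum u) (toℕ a) (toℕ b) 3 eq ⟩
  toℕ b % 3  ≡⟨ m<n⇒m%n≡m (toℕ<n b) ⟩
  toℕ b      ∎))
  where open ≡-Reasoning
... | inj₂ (refl , adj′) =
  Adjacent⇒coordSum%3≢ u v adj′ (%-cancelˡ-+ (toℕ a) (coordSum u) (coordSum v) 3 eq)

A-independent : ∀ (u v : Vertex m) → A m u → A m v → ¬ Adjacent u v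
A-independent u v au av adj = Adjacent⇒coordSum%3≢ u v adj (trans au (sym av))

A-∷ʳ-zero⁻ : ∀ (u : Vertex m) → A (suc m) (u ∷ʳ zero) → A m u
A-∷ʳ-zero⁻ u = subst (λ s → s % 3 ≡ 0) (trans (coordSum-∷ʳ u zero) (+-identityʳ _))

A-∷ʳ⁻ : ∀ (u : Vertex m) → A m u → A (suc m) (u ∷ʳ a) → a ≡ zero
A-∷ʳ⁻ {a = a} u au aua = toℕ-injective (begin
  toℕ a                     ≡⟨ m<n⇒m%n≡m (toℕ<n a) ⟨
  toℕ a % 3                 ≡⟨ %-remove-+ˡ {coordSum u} (toℕ a) (m%n≡0⇒n∣m (coordSum u) 3 au) ⟨
  (coordSum u + toℕ a) % 3  ≡⟨ cong (_% 3) (coordSum-∷ʳ u a) ⟨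
  coordSum (u ∷ʳ a) % 3     ≡⟨ aua ⟩
  0                         ∎)
  where open ≡-Reasoning

ℤ₃-other-nonzero : a ≢ zero → ∃[ b ] ((b ≢ zero × a ≢ b) × (∀ c → c ≢ zero → a ≢ c → c ≡ b))
ℤ₃-other-nonzero {a = zero} a≢0 = ⊥-elim (a≢0 refl)
ℤ₃-other-nonzero {a = suc zero} _ = suc (suc zero) , ((λ ()) , (λ ())) , λ where
  zero             c≢0 _   → ⊥-elim (c≢0 refl)
  (suc zero)       _   a≢c → ⊥-elim (a≢c refl)
  (suc (suc zero)) _   _   → refl
ℤ₃-other-nonzero {a = suc (suc zero)} _ = suc zero , ((λ ()) , (λ ())) , λ where
  zero             c≢0 _   → ⊥-elim (c≢0 refl)
  (suc zero)       _   _   → refl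
  (suc (suc zero)) _   a≢c → ⊥-elim (a≢c refl)

-- D 0 is empty and D 1 = (A 0, 1) ∪ (A 0, 2), so the recursion defining D
-- holds from n = 0 on.
D-∷ʳ⁻ : D (suc m) (u ∷ʳ a) → (a ≡ zero × D m u) ⊎ (a ≢ zero × A m u)
D-∷ʳ⁻ {u = []} (D-one a≢0) = inj₂ (a≢0 , refl)
D-∷ʳ⁻ {u = u} {a = a} (D-zero du l) =
  inj₁ (trans (sym (last-∷ʳ a u)) l , subst (D _) (init-∷ʳ a u) du)
D-∷ʳ⁻ {u = u} {a = a} (D-one' au l) =
  inj₂ (subst (_≢ zero) (trans (sym l) (last-∷ʳ a u)) (λ ()) , subst (A _) (init-∷ʳ a u) au)
D-∷ʳ⁻ {u = u} {a = a} (D-two au l) =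
  inj₂ (subst (_≢ zero) (trans (sym l) (last-∷ʳ a u)) (λ ()) , subst (A _) (init-∷ʳ a u) au)

D-∷ʳ-zero : D m u → D (suc m) (u ∷ʳ zero)
D-∷ʳ-zero {m = suc _} {u = u} du = D-zero (subst (D _) (sym (init-∷ʳ zero u)) du) (last-∷ʳ zero u)

D-∷ʳ-nonzero : A m u → a ≢ zero → D (suc m) (u ∷ʳ a)
D-∷ʳ-nonzero {m = zero} {u = []} _ a≢0 = D-one a≢0
D-∷ʳ-nonzero {a = zero} _ a≢0 = ⊥-elim (a≢0 refl)
D-∷ʳ-nonzero {m = suc _} {u = u} {a = suc zero} au _ =
  D-one' (subst (A _) (sym (init-∷ʳ _ u)) au) (last-∷ʳ _ u)
D-∷ʳ-nonzero {m = suc _} {u = u} {a = suc (suc zero)} au _ =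
  D-two (subst (A _) (sym (init-∷ʳ _ u)) au) (last-∷ʳ _ u)

D⇒¬A : {x : Vertex m} → D m x → ¬ A m x
D⇒¬A {m = suc _} {x} dx ax with initLast x
... | u , a , refl with D-∷ʳ⁻ dx
...   | inj₁ (refl , du) = D⇒¬A du (A-∷ʳ-zero⁻ u ax)
...   | inj₂ (a≢0 , au)  = a≢0 (A-∷ʳ⁻ u au ax)

DegreeOneIn-∷ʳ-zero : D m u → DegreeOneIn (D m) u → DegreeOneIn (D (suc m)) (u ∷ʳ zero)
DegreeOneIn-∷ʳ-zero {m = m} {u = u} du (y , (dy , u~y) , unique) =
  y ∷ʳ zero , (D-∷ʳ-zero dy , Adjacent-∷ʳ-init u y u~y) , unique′
  where
  unique′ : ∀ z → D (suc m) z → Adjacent (u ∷ʳ zero) z → z ≡ y ∷ʳ zero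
  unique′ z dz adj with initLast z
  ... | v , c , refl with D-∷ʳ⁻ dz | Adjacent-∷ʳ⁻ u v adj
  ... | inj₁ (refl , dv) | inj₁ (_ , u~v)  = cong (_∷ʳ zero) (unique v dv u~v)
  ... | inj₁ (refl , _)  | inj₂ (0≢0 , _)  = ⊥-elim (0≢0 refl)
  ... | inj₂ (c≢0 , _)   | inj₁ (0≡c , _)  = ⊥-elim (c≢0 (sym 0≡c))
  ... | inj₂ (_ , av)    | inj₂ (_ , refl) = ⊥-elim (D⇒¬A du av)

DegreeOneIn-∷ʳ-nonzero : ∀ (u : Vertex m) → A m u → a ≢ zero → DegreeOneIn (D (suc m)) (u ∷ʳ a)
DegreeOneIn-∷ʳ-nonzero {m = m} {a = a} u au a≢0 with ℤ₃-other-nonzero a≢0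
... | b , (b≢0 , a≢b) , unique-b =
  u ∷ʳ b , (D-∷ʳ-nonzero au b≢0 , Adjacent-∷ʳ-last u a≢b) , unique′
  where
  unique′ : ∀ z → D (suc m) z → Adjacent (u ∷ʳ a) z → z ≡ u ∷ʳ b
  unique′ z dz adj with initLast z
  ... | v , c , refl with D-∷ʳ⁻ dz | Adjacent-∷ʳ⁻ u v adj
  ... | inj₁ (_ , dv)    | inj₂ (_ , refl)   = ⊥-elim (D⇒¬A dv au)
  ... | inj₁ (refl , _)  | inj₁ (a≡0 , _)    = ⊥-elim (a≢0 a≡0)
  ... | inj₂ (_ , av)    | inj₁ (refl , u~v) = ⊥-elim (A-independent u v au av u~v)
  ... | inj₂ (c≢0 , _)   | inj₂ (a≢c , refl) = cong (u ∷ʳ_) (unique-b c c≢0 a≢c)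

D⇒DegreeOneIn : {x : Vertex m} → D m x → DegreeOneIn (D m) x
D⇒DegreeOneIn {m = suc _} {x} dx with initLast x
... | u , a , refl with D-∷ʳ⁻ dx
...   | inj₁ (refl , du) = DegreeOneIn-∷ʳ-zero du (D⇒DegreeOneIn du)
...   | inj₂ (a≢0 , au)  = DegreeOneIn-∷ʳ-nonzero u au a≢0

proposition3p3 : (n : ℕ) →
    ((x : Vertex (suc n)) → ¬ (A (suc n) x × D (suc n) x)) ×
    ((x : Vertex (suc n)) → D (suc n) x → DegreeOneIn (D (suc n)) x)
proposition3p3 n = (λ _ (ax , dx) → D⇒¬A dx ax) , λ _ → D⇒DegreeOneIn
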